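{- Let $(F_n)_{n\ge 0}$ be the Fibonacci numbers, and for $n\ge 2$ consider the two equations in unknowns $x,y$: \begin{align*} (\mathrm{A}_n)\quad & F_n^2x + F_{n+1}^2y \ =\ \frac{(F_n^2-1)(F_{n+1}^2-1)}{2},\\ (\mathrm{B}_n)\quad & 1+ F_n^2x + F_{n+1}^2y \ =\ \frac{(F_n^2-1)(F_{n+1}^2-1)}{2}. \end{align*} Then: (i) For $n\ge 2$ with $n\equiv 0,2,3,5 \pmod 6$, $(x,y)=\left(F_n^2 - \frac{F_{n-1}^2+1}{2}, \frac{F_{n-1}^2-1}{2}\right)$ is the unique nonnegative integral solution of $(\mathrm{A}_n)$. (ii) For $n\ge 2$ with $n\equiv 1\pmod 6$, $(x,y)=\left(\frac{F_n^2-3}{2}, \frac{F_n^2-F_{n-1}^2-1}{2}\right)$ is the unique nonnegative integral solution of $(\mathrm{B}_n)$. (iii) For $n\ge 2$ with $n\equiv 4\pmod 6$, $(x,y)=\left(\frac{F_n^2+1}{2}, \frac{F_n^2-F_{n-1}^2-1}{2}\right)$ is the unique nonnegative integral solution of $(\mathrm{B}_n)$.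
   Context: The Fibonacci numbers are defined by $F_0=0$, $F_1=1$, and $F_n=F_{n-1}+F_{n-2}$ for $n\ge 2$. -}

module Defs where

open import Data.Nat using (ℕ; zero; suc; _+_; _*_; _∸_; _^_; _/_)
open import Data.Nat.Divisibility using (_∣_)
open import Data.Product using (_×_)
open import Relation.Binary.PropositionalEquality using (_≡_)

F : ℕ → ℕ
F zero = 0
F (suc zero) = 1
F (suc (suc n)) = F (suc n) + F n

-- Right-hand side (F_n^2 - 1)(F_{n+1}^2 - 1) / 2.  For n ≥ 2 both F_n, F_{n+1} ≥ 1,
-- so truncated subtraction is exact; the product is always even, so the division is exact.
RHS : ℕ → ℕ
RHS n = ((F n ^ 2 ∸ 1) * (F (suc n) ^ 2 ∸ 1)) / 2

EqA : ℕ → ℕ → ℕ → Set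
EqA n x y = F n ^ 2 * x + F (suc n) ^ 2 * y ≡ RHS n

EqB : ℕ → ℕ → ℕ → Set
EqB n x y = 1 + F n ^ 2 * x + F (suc n) ^ 2 * y ≡ RHS n

UniqueSol : (ℕ → ℕ → Set) → ℕ → ℕ → Set
UniqueSol E x₀ y₀ = E x₀ y₀ × (∀ x y → E x y → x ≡ x₀ × y ≡ y₀)

-- For coprime A and B, the map (x, y) ↦ A x + B y is injective on the pairs with
-- A x + B y < A B, and (A − 1)(B − 1)/2 < A B. With A = F n ², B = F (n + 1)² (coprime by
-- Cassini's identity) each claimed pair is therefore the unique solution as soon as it
-- is a solution, i.e. as soon as 2 (k + A x₀ + B y₀) + A + B = A B + 1, where k = 0 for
-- (A_n) and k = 1 for (B_n). With C = F (n − 1)², Cassini's identity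
-- F (n − 1) F (n + 1) − F n ² = (−1)ⁿ yields 2 A² + B C = A B + A C + 1 for every n,
-- (A − 1)² = B C for odd n and (A + 1)² = B C for even n, which are exactly the
-- identities needed. The halvings are exact because of the parities of F (n − 1) and
-- F n, which depend on n mod 3; with the Cassini sign, the case split is by n mod 6.

module Submission where

open import Defs
open import Data.Nat using (ℕ; zero; suc; _+_; _*_; _∸_; _^_; _/_; _%_; _≤_; _<_; z≤n; s≤s; >-nonZero)
open import Data.Nat.Properties
open import Data.Nat.Divisibility using (_∣_; divides; ∣m+n∣m⇒∣n; m∣m*n; n∣m*n; ∣⇒≤; ∣1⇒≡1; ∣-trans)
open import Data.Nat.DivMod using (m*n/n≡m; m/n*n≡m; m≡m%n+[m/n]*n)
open import Data.Nat.Coprimality using (Coprime; coprime-divisor)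
import Data.Nat.Coprimality as Coprime
open import Data.Nat.Tactic.RingSolver using (solve)
open import Data.List.Base using (_∷_; [])
open import Data.Product using (_×_; _,_; ∃-syntax)
open import Data.Sum using (_⊎_; inj₁; inj₂; [_,_]′)
open import Function using (_∘_)
open import Data.Empty using (⊥-elim)
open import Relation.Binary.PropositionalEquality
open import Relation.Binary.Definitions using (tri<; tri≈; tri>)

private
  variable
    a c d m n A B C X Y x y x₀ y₀ : ℕ

m^2≡m*m : ∀ m → m ^ 2 ≡ m * m
m^2≡m*m m = cong (m *_) (*-identityʳ m)

1≤n^2 : 1 ≤ n → 1 ≤ n ^ 2
1≤n^2 {suc n} _ = s≤s z≤n

coprime-^ : ∀ k → Coprime m n → Coprime m (n ^ k)
coprime-^ zero _ (_ , d∣1) = ∣1⇒≡1 d∣1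
coprime-^ {m} {n} (suc k) m⊥n {d} (d∣m , d∣n*nᵏ) =
  coprime-^ k m⊥n (d∣m , coprime-divisor d⊥n d∣n*nᵏ)
  where
  d⊥n : Coprime d n
  d⊥n (e∣d , e∣n) = m⊥n (∣-trans e∣d d∣m , e∣n)

coprime-^2 : Coprime m n → Coprime (m ^ 2) (n ^ 2)
coprime-^2 m⊥n = Coprime.sym (coprime-^ 2 (Coprime.sym (coprime-^ 2 m⊥n)))

-- If x < x₀ then B ∣ A (x₀ ∸ x), so B ≤ x₀ ∸ x and A x₀ + B y₀ ≥ A B.
x<x₀⇒AB≤Ax₀+By₀ : Coprime B A → A * x + B * y ≡ A * x₀ + B * y₀ → x < x₀ →
                   A * B ≤ A * x₀ + B * y₀
x<x₀⇒AB≤Ax₀+By₀ {B} {A} {x} {y} {x₀} {y₀} B⊥A eq x<x₀ = begin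
  A * B           ≤⟨ *-monoʳ-≤ A B≤t ⟩
  A * t           ≤⟨ *-monoʳ-≤ A (m≤n+m t x) ⟩
  A * (x + t)     ≡⟨ cong (A *_) x+t≡x₀ ⟩
  A * x₀          ≤⟨ m≤m+n (A * x₀) (B * y₀) ⟩
  A * x₀ + B * y₀ ∎
  where
  open ≤-Reasoning
  t = x₀ ∸ x
  x+t≡x₀ : x + t ≡ x₀
  x+t≡x₀ = m+[n∸m]≡n (<⇒≤ x<x₀)
  By≡By₀+At : B * y ≡ B * y₀ + A * t
  By≡By₀+At = +-cancelˡ-≡ (A * x) _ _ (begin-equality
    A * x + B * y               ≡⟨ eq ⟩
    A * x₀ + B * y₀             ≡⟨ cong (λ z → A * z + B * y₀) x+t≡x₀ ⟨
    A * (x + t) + B * y₀        ≡⟨ cong (_+ B * y₀) (*-distribˡ-+ A x t) ⟩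
    A * x + A * t + B * y₀      ≡⟨ +-assoc (A * x) (A * t) (B * y₀) ⟩
    A * x + (A * t + B * y₀)    ≡⟨ cong (A * x +_) (+-comm (A * t) (B * y₀)) ⟩
    A * x + (B * y₀ + A * t)    ∎)
  B∣t : B ∣ t
  B∣t = coprime-divisor B⊥A (∣m+n∣m⇒∣n (subst (B ∣_) By≡By₀+At (m∣m*n y)) (m∣m*n y₀))
  B≤t : B ≤ t
  B≤t = ∣⇒≤ ⦃ >-nonZero (m<n⇒0<n∸m x<x₀) ⦄ B∣t

Ax+By-injective : Coprime A B → A * x₀ + B * y₀ < A * B → A * x + B * y ≡ A * x₀ + B * y₀ →
                  x ≡ x₀ × y ≡ y₀
Ax+By-injective {A} {B} {x₀} {y₀} {x} {y} A⊥B bound eq with <-cmp x x₀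
... | tri< x<x₀ _ _ = ⊥-elim (<⇒≱ bound (x<x₀⇒AB≤Ax₀+By₀ (Coprime.sym A⊥B) eq x<x₀))
... | tri> _ _ x₀<x = ⊥-elim (<⇒≱ (subst (_< A * B) (sym eq) bound)
                                  (x<x₀⇒AB≤Ax₀+By₀ (Coprime.sym A⊥B) (sym eq) x₀<x))
... | tri≈ _ refl _ = refl , *-cancelˡ-≡ y y₀ B ⦃ B≢0 ⦄ (+-cancelˡ-≡ (A * x) _ _ eq)
  where B≢0 = m*n≢0⇒n≢0 A ⦃ >-nonZero (≤-<-trans z≤n bound) ⦄

[A∸1][B∸1]/2≡N : ∀ {A B} N → 1 ≤ A → 1 ≤ B → N * 2 + A + B ≡ A * B + 1 →
                 ((A ∸ 1) * (B ∸ 1)) / 2 ≡ N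
[A∸1][B∸1]/2≡N {suc A} {suc B} N _ _ h = begin
  (A * B) / 2  ≡⟨ cong (_/ 2) (+-cancelʳ-≡ (suc A + suc B) (A * B) (N * 2) AB+A+B≡N*2+A+B) ⟩
  (N * 2) / 2  ≡⟨ m*n/n≡m N 2 ⟩
  N            ∎
  where
  open ≡-Reasoning
  AB+A+B≡N*2+A+B : A * B + (suc A + suc B) ≡ N * 2 + (suc A + suc B)
  AB+A+B≡N*2+A+B = begin
    A * B + (suc A + suc B)   ≡⟨ solve (A ∷ B ∷ []) ⟩
    suc A * suc B + 1         ≡⟨ h ⟨
    N * 2 + suc A + suc B     ≡⟨ +-assoc (N * 2) (suc A) (suc B) ⟩
    N * 2 + (suc A + suc B)   ∎

N<AB : ∀ {A B} N → 1 ≤ A → 1 ≤ B → N * 2 + A + B ≡ A * B + 1 → N < A * B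
N<AB {A} {B} N 1≤A 1≤B h = ≤-pred (begin
  2 + N            ≤⟨ +-monoʳ-≤ 2 (m≤m*n N 2) ⟩
  2 + N * 2        ≤⟨ +-monoˡ-≤ (N * 2) (+-mono-≤ 1≤A 1≤B) ⟩
  A + B + N * 2    ≡⟨ +-comm (A + B) (N * 2) ⟩
  N * 2 + (A + B)  ≡⟨ +-assoc (N * 2) A B ⟨
  N * 2 + A + B    ≡⟨ h ⟩
  A * B + 1        ≡⟨ +-comm (A * B) 1 ⟩
  1 + A * B        ∎)
  where open ≤-Reasoning

uniqueSol-k+Ax+By : ∀ k → 1 ≤ A → 1 ≤ B → Coprime A B →
                    (k + A * x₀ + B * y₀) * 2 + A + B ≡ A * B + 1 →
                    UniqueSol (λ x y → k + A * x + B * y ≡ ((A ∸ 1) * (B ∸ 1)) / 2) x₀ y₀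
uniqueSol-k+Ax+By {A} {B} {x₀} {y₀} k 1≤A 1≤B A⊥B h =
  sym rhs≡N , λ x y eq → Ax+By-injective A⊥B bound (drop-k (trans eq rhs≡N))
  where
  N = k + A * x₀ + B * y₀
  rhs≡N = [A∸1][B∸1]/2≡N N 1≤A 1≤B h
  bound : A * x₀ + B * y₀ < A * B
  bound = ≤-<-trans (+-monoˡ-≤ (B * y₀) (m≤n+m (A * x₀) k)) (N<AB N 1≤A 1≤B h)
  drop-k : ∀ {x y} → k + A * x + B * y ≡ N → A * x + B * y ≡ A * x₀ + B * y₀
  drop-k {x} {y} eq = +-cancelˡ-≡ k _ _
    (trans (sym (+-assoc k (A * x) (B * y))) (trans eq (+-assoc k (A * x₀) (B * y₀))))

-- Both identities are checked after adding the same term to each side, so that no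
-- subtraction occurs.
eqA-identity : Y * 2 + 1 ≡ C → X + (Y + 1) ≡ A → A * A * 2 + B * C ≡ A * B + A * C + 1 →
               (A * X + B * Y) * 2 + A + B ≡ A * B + 1
eqA-identity {Y} {C} {X} {A} {B} hC hA rel = +-cancelʳ-≡ (A * (Y + 1) * 2) _ _ (begin
  (A * X + B * Y) * 2 + A + B + A * (Y + 1) * 2  ≡⟨ solve (A ∷ B ∷ X ∷ Y ∷ []) ⟩
  A * (X + (Y + 1)) * 2 + B * (Y * 2 + 1) + A    ≡⟨ cong₂ (λ u v → A * u * 2 + B * v + A) hA hC ⟩
  A * A * 2 + B * C + A                          ≡⟨ cong (_+ A) rel ⟩
  A * B + A * C + 1 + A                          ≡⟨ cong (λ v → A * B + A * v + 1 + A) hC ⟨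
  A * B + A * (Y * 2 + 1) + 1 + A                ≡⟨ solve (A ∷ B ∷ Y ∷ []) ⟩
  A * B + 1 + A * (Y + 1) * 2                    ∎)
  where open ≡-Reasoning

eqB-identity : Y * 2 + (C + 1) ≡ A → A * (X * 2 + 1) + 1 ≡ C * B →
               (1 + A * X + B * Y) * 2 + A + B ≡ A * B + 1
eqB-identity {Y} {C} {A} {X} {B} hA hX = +-cancelʳ-≡ (B * (C + 1)) _ _ (begin
  (1 + A * X + B * Y) * 2 + A + B + B * (C + 1)            ≡⟨ solve (A ∷ B ∷ C ∷ X ∷ Y ∷ []) ⟩
  A * (X * 2 + 1) + 1 + B * (Y * 2 + (C + 1)) + 1 + B     ≡⟨ cong₂ (λ u v → u + B * v + 1 + B) hX hA ⟩
  C * B + B * A + 1 + B                                   ≡⟨ solve (A ∷ B ∷ C ∷ []) ⟩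
  A * B + 1 + B * (C + 1)                                 ∎)
  where open ≡-Reasoning

Even Odd : ℕ → Set
Even n = 2 ∣ n
Odd n = ∃[ k ] n ≡ 1 + k * 2

odd⇒1≤ : Odd n → 1 ≤ n
odd⇒1≤ (_ , refl) = s≤s z≤n

odd+even : Odd m → Even n → Odd (m + n)
odd+even (k , refl) (divides j refl) = k + j , cong suc (sym (*-distribʳ-+ 2 k j))

even+odd : Even m → Odd n → Odd (m + n)
even+odd {m} {n} m-even n-odd = subst Odd (+-comm n m) (odd+even n-odd m-even)

odd+odd : Odd m → Odd n → Even (m + n)
odd+odd (k , refl) (j , refl) = divides (suc (k + j)) (begin
  1 + k * 2 + (1 + j * 2)  ≡⟨ solve (k ∷ j ∷ []) ⟩
  suc (k + j) * 2          ∎)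
  where open ≡-Reasoning

odd^2 : Odd n → Odd (n ^ 2)
odd^2 (k , refl) = k * (1 + k) * 2 , (begin
  (1 + k * 2) ^ 2              ≡⟨ m^2≡m*m (1 + k * 2) ⟩
  (1 + k * 2) * (1 + k * 2)    ≡⟨ solve (k ∷ []) ⟩
  1 + k * (1 + k) * 2 * 2      ∎)
  where open ≡-Reasoning

even^2 : Even n → Even (n ^ 2)
even^2 (divides j refl) = divides (j * j * 2) (begin
  (j * 2) ^ 2          ≡⟨ m^2≡m*m (j * 2) ⟩
  j * 2 * (j * 2)      ≡⟨ solve (j ∷ []) ⟩
  j * j * 2 * 2        ∎)
  where open ≡-Reasoning

odd∸even∸1-even : Odd A → Even C → Even (A ∸ C ∸ 1)
odd∸even∸1-even (k , refl) (divides j refl) = divides (k ∸ j) (begin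
  suc (k * 2) ∸ j * 2 ∸ 1    ≡⟨ ∸-+-assoc (suc (k * 2)) (j * 2) 1 ⟩
  suc (k * 2) ∸ (j * 2 + 1)  ≡⟨ cong (suc (k * 2) ∸_) (+-comm (j * 2) 1) ⟩
  k * 2 ∸ j * 2              ≡⟨ *-distribʳ-∸ 2 k j ⟨
  (k ∸ j) * 2                ∎)
  where open ≡-Reasoning

[A∸C∸1]/2*2+[C+1]≡A : Odd A → Even C → C < A → (A ∸ C ∸ 1) / 2 * 2 + (C + 1) ≡ A
[A∸C∸1]/2*2+[C+1]≡A {A} {C} A-odd C-even C<A = begin
  (A ∸ C ∸ 1) / 2 * 2 + (C + 1)  ≡⟨ cong (_+ (C + 1)) (m/n*n≡m (odd∸even∸1-even A-odd C-even)) ⟩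
  A ∸ C ∸ 1 + (C + 1)            ≡⟨ cong (_+ (C + 1)) (∸-+-assoc A C 1) ⟩
  A ∸ (C + 1) + (C + 1)          ≡⟨ m∸n+n≡m (subst (_≤ A) (+-comm 1 C) C<A) ⟩
  A                              ∎
  where open ≡-Reasoning

Part-i Part-ii Part-iii : ℕ → ℕ → ℕ → Set
Part-i A B C = (2 ∣ C + 1) × (2 ∣ C ∸ 1) ×
  UniqueSol (λ x y → A * x + B * y ≡ ((A ∸ 1) * (B ∸ 1)) / 2) (A ∸ (C + 1) / 2) ((C ∸ 1) / 2)
Part-ii A B C = (2 ∣ A ∸ 3) × (2 ∣ A ∸ C ∸ 1) ×
  UniqueSol (λ x y → 1 + A * x + B * y ≡ ((A ∸ 1) * (B ∸ 1)) / 2) ((A ∸ 3) / 2) ((A ∸ C ∸ 1) / 2)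
Part-iii A B C = (2 ∣ A + 1) × (2 ∣ A ∸ C ∸ 1) ×
  UniqueSol (λ x y → 1 + A * x + B * y ≡ ((A ∸ 1) * (B ∸ 1)) / 2) ((A + 1) / 2) ((A ∸ C ∸ 1) / 2)

squares-part-i : Odd C → C ≤ A → 1 ≤ B → Coprime A B → A * A * 2 + B * C ≡ A * B + A * C + 1 →
                 Part-i A B C
squares-part-i {C} {A} (k , refl) C≤A 1≤B A⊥B rel =
  divides (suc k) C+1≡[1+k]*2 , divides k refl ,
  uniqueSol-k+Ax+By 0 (≤-trans (s≤s z≤n) C≤A) 1≤B A⊥B (eqA-identity hC hA rel)
  where
  open ≡-Reasoning
  C+1≡[1+k]*2 : C + 1 ≡ suc k * 2
  C+1≡[1+k]*2 = cong suc (+-comm (k * 2) 1)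
  hC : (C ∸ 1) / 2 * 2 + 1 ≡ C
  hC = trans (cong (λ z → z * 2 + 1) (m*n/n≡m k 2)) (+-comm (k * 2) 1)
  hA : A ∸ (C + 1) / 2 + ((C ∸ 1) / 2 + 1) ≡ A
  hA = begin
    A ∸ (C + 1) / 2 + ((C ∸ 1) / 2 + 1)  ≡⟨ cong₂ (λ u v → A ∸ u + (v + 1))
                                               (trans (cong (_/ 2) C+1≡[1+k]*2) (m*n/n≡m (suc k) 2))
                                               (m*n/n≡m k 2) ⟩
    A ∸ suc k + (k + 1)                  ≡⟨ cong (A ∸ suc k +_) (+-comm k 1) ⟩
    A ∸ suc k + suc k                    ≡⟨ m∸n+n≡m (≤-trans (s≤s (m≤m*n k 2)) C≤A) ⟩
    A                                    ∎

squares-part-ii : Odd A → 3 ≤ A → Even C → C < A → 1 ≤ B → Coprime A B →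
                  (A ∸ 1) * (A ∸ 1) ≡ C * B → Part-ii A B C
squares-part-ii (zero , refl) (s≤s ())
squares-part-ii {C = C} {B} A-odd@(suc k , refl) _ C-even C<A 1≤B A⊥B rel =
  divides k refl , odd∸even∸1-even A-odd C-even ,
  uniqueSol-k+Ax+By 1 (s≤s z≤n) 1≤B A⊥B
    (eqB-identity {A = 3 + k * 2} {X = (k * 2) / 2} ([A∸C∸1]/2*2+[C+1]≡A A-odd C-even C<A) hX)
  where
  open ≡-Reasoning
  hX : (3 + k * 2) * ((k * 2) / 2 * 2 + 1) + 1 ≡ C * B
  hX = begin
    (3 + k * 2) * ((k * 2) / 2 * 2 + 1) + 1  ≡⟨ cong (λ z → (3 + k * 2) * (z * 2 + 1) + 1) (m*n/n≡m k 2) ⟩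
    (3 + k * 2) * (k * 2 + 1) + 1            ≡⟨ solve (k ∷ []) ⟩
    (2 + k * 2) * (2 + k * 2)                ≡⟨ rel ⟩
    C * B                                    ∎

squares-part-iii : Odd A → Even C → C < A → 1 ≤ B → Coprime A B →
                   (A + 1) * (A + 1) ≡ C * B → Part-iii A B C
squares-part-iii {A} {C} {B} A-odd C-even C<A 1≤B A⊥B rel =
  A+1-even , odd∸even∸1-even A-odd C-even ,
  uniqueSol-k+Ax+By 1 1≤A 1≤B A⊥B (eqB-identity ([A∸C∸1]/2*2+[C+1]≡A A-odd C-even C<A) hX)
  where
  open ≡-Reasoning
  A+1-even : Even (A + 1)
  A+1-even = odd+odd A-odd (0 , refl)
  1≤A : 1 ≤ A
  1≤A = ≤-trans (s≤s z≤n) C<A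
  hX : A * ((A + 1) / 2 * 2 + 1) + 1 ≡ C * B
  hX = begin
    A * ((A + 1) / 2 * 2 + 1) + 1  ≡⟨ cong (λ z → A * (z + 1) + 1) (m/n*n≡m A+1-even) ⟩
    A * (A + 1 + 1) + 1            ≡⟨ solve (A ∷ []) ⟩
    (A + 1) * (A + 1)              ≡⟨ rel ⟩
    C * B                          ∎

Cassini⁺ Cassini⁻ Cassini : ℕ → ℕ → Set
Cassini⁺ m n = m * (n + m) ≡ n * n + 1
Cassini⁻ m n = m * (n + m) + 1 ≡ n * n
Cassini m n = Cassini⁺ m n ⊎ Cassini⁻ m n

cassini⁺-next : ∀ m n → Cassini⁺ m n → Cassini⁻ n (n + m)
cassini⁺-next m n h = begin
  n * (n + m + n) + 1          ≡⟨ solve (m ∷ n ∷ []) ⟩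
  n * (n + m) + (n * n + 1)    ≡⟨ cong (n * (n + m) +_) h ⟨
  n * (n + m) + m * (n + m)    ≡⟨ solve (m ∷ n ∷ []) ⟩
  (n + m) * (n + m)            ∎
  where open ≡-Reasoning

cassini⁻-next : ∀ m n → Cassini⁻ m n → Cassini⁺ n (n + m)
cassini⁻-next m n h = begin
  n * (n + m + n)                  ≡⟨ solve (m ∷ n ∷ []) ⟩
  n * (n + m) + n * n              ≡⟨ cong (n * (n + m) +_) h ⟨
  n * (n + m) + (m * (n + m) + 1)  ≡⟨ solve (m ∷ n ∷ []) ⟩
  (n + m) * (n + m) + 1            ∎
  where open ≡-Reasoning

cassini⇒coprime : Cassini m n → Coprime n (n + m)
cassini⇒coprime {m} {n} cas {d} (d∣n , d∣n+m) = ∣1⇒≡1 (d∣1 cas)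
  where
  d∣nn : d ∣ n * n
  d∣nn = ∣-trans d∣n (m∣m*n n)
  d∣m[n+m] : d ∣ m * (n + m)
  d∣m[n+m] = ∣-trans d∣n+m (n∣m*n m)
  d∣1 : Cassini m n → d ∣ 1
  d∣1 (inj₁ h) = ∣m+n∣m⇒∣n (subst (d ∣_) h d∣m[n+m]) d∣nn
  d∣1 (inj₂ h) = ∣m+n∣m⇒∣n (subst (d ∣_) (sym h) d∣nn) d∣m[n+m]

adjacent-squares : m ≡ n + 1 ⊎ n ≡ m + 1 → m * m + n * n ≡ m * n * 2 + 1
adjacent-squares {n = n} (inj₁ refl) = solve (n ∷ [])
adjacent-squares {m}     (inj₂ refl) = solve (m ∷ [])

c^2*b^2≡[cb]² : ∀ c b → c ^ 2 * b ^ 2 ≡ c * b * (c * b)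
c^2*b^2≡[cb]² c b = trans (cong₂ _*_ (m^2≡m*m c) (m^2≡m*m b)) (solve (c ∷ b ∷ []))

-- (a² − c (a + c))² = 1, written in the squares A = a², B = (a + c)², C = c².
cassini⇒square-relation : Cassini c a →
  a ^ 2 * a ^ 2 * 2 + (a + c) ^ 2 * c ^ 2 ≡ a ^ 2 * (a + c) ^ 2 + a ^ 2 * c ^ 2 + 1
cassini⇒square-relation {c} {a} cas
  rewrite m^2≡m*m a | m^2≡m*m c | m^2≡m*m (a + c) = begin
  a * a * (a * a) * 2 + (a + c) * (a + c) * (c * c)            ≡⟨ solve (a ∷ c ∷ []) ⟩
  a * a * (a * a) + (a * a * (a * a) + c * (a + c) * (c * (a + c)))
      ≡⟨ cong (a * a * (a * a) +_) (adjacent-squares adjacent) ⟩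
  a * a * (a * a) + (a * a * (c * (a + c)) * 2 + 1)          ≡⟨ solve (a ∷ c ∷ []) ⟩
  a * a * ((a + c) * (a + c)) + a * a * (c * c) + 1            ∎
  where
  open ≡-Reasoning
  adjacent : a * a ≡ c * (a + c) + 1 ⊎ c * (a + c) ≡ a * a + 1
  adjacent = [ inj₂ , inj₁ ∘ sym ]′ cas

cassini⁺⇒[A+1]²≡CB : Cassini⁺ c a → (a ^ 2 + 1) * (a ^ 2 + 1) ≡ c ^ 2 * (a + c) ^ 2
cassini⁺⇒[A+1]²≡CB {c} {a} h = begin
  (a ^ 2 + 1) * (a ^ 2 + 1)   ≡⟨ cong (λ z → (z + 1) * (z + 1)) (m^2≡m*m a) ⟩
  (a * a + 1) * (a * a + 1)   ≡⟨ cong (λ z → z * z) h ⟨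
  c * (a + c) * (c * (a + c)) ≡⟨ c^2*b^2≡[cb]² c (a + c) ⟨
  c ^ 2 * (a + c) ^ 2         ∎
  where open ≡-Reasoning

cassini⁻⇒[A∸1]²≡CB : Cassini⁻ c a → (a ^ 2 ∸ 1) * (a ^ 2 ∸ 1) ≡ c ^ 2 * (a + c) ^ 2
cassini⁻⇒[A∸1]²≡CB {c} {a} h = begin
  (a ^ 2 ∸ 1) * (a ^ 2 ∸ 1)   ≡⟨ cong (λ z → z * z) A∸1≡cb ⟩
  c * (a + c) * (c * (a + c)) ≡⟨ c^2*b^2≡[cb]² c (a + c) ⟨
  c ^ 2 * (a + c) ^ 2         ∎
  where
  open ≡-Reasoning
  A∸1≡cb : a ^ 2 ∸ 1 ≡ c * (a + c)
  A∸1≡cb = trans (cong (_∸ 1) (trans (m^2≡m*m a) (sym h))) (m+n∸n≡m (c * (a + c)) 1)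

pair-part-i : Odd c → Cassini c (c + d) → Part-i ((c + d) ^ 2) ((c + d + c) ^ 2) (c ^ 2)
pair-part-i {c} {d} c-odd cas =
  squares-part-i (odd^2 c-odd) (^-monoˡ-≤ 2 (m≤m+n c d)) (1≤n^2 1≤b)
    (coprime-^2 (cassini⇒coprime {c} {c + d} cas)) (cassini⇒square-relation {c} {c + d} cas)
  where
  1≤b : 1 ≤ c + d + c
  1≤b = ≤-trans (odd⇒1≤ c-odd) (m≤n+m c (c + d))

pair-part-ii : Even c → Odd d → 1 ≤ c → Cassini⁻ c (c + d) →
               Part-ii ((c + d) ^ 2) ((c + d + c) ^ 2) (c ^ 2)
pair-part-ii {c} {d} c-even d-odd 1≤c cas =
  squares-part-ii (odd^2 (even+odd c-even d-odd)) 3≤A (even^2 c-even) (^-monoˡ-< 2 (m<m+n c 1≤d))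
    (1≤n^2 1≤b) (coprime-^2 (cassini⇒coprime {c} {c + d} (inj₂ cas)))
    (cassini⁻⇒[A∸1]²≡CB {c} {c + d} cas)
  where
  1≤d = odd⇒1≤ d-odd
  1≤b : 1 ≤ c + d + c
  1≤b = ≤-trans 1≤c (m≤n+m c (c + d))
  3≤A : 3 ≤ (c + d) ^ 2
  3≤A = ≤-trans (n≤1+n 3) (^-monoˡ-≤ 2 (+-mono-≤ 1≤c 1≤d))

pair-part-iii : Even c → Odd d → Cassini⁺ c (c + d) →
                Part-iii ((c + d) ^ 2) ((c + d + c) ^ 2) (c ^ 2)
pair-part-iii {c} {d} c-even d-odd cas =
  squares-part-iii (odd^2 (even+odd c-even d-odd)) (even^2 c-even) (^-monoˡ-< 2 (m<m+n c 1≤d))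
    (1≤n^2 1≤b) (coprime-^2 (cassini⇒coprime {c} {c + d} (inj₁ cas)))
    (cassini⁺⇒[A+1]²≡CB {c} {c + d} cas)
  where
  1≤d = odd⇒1≤ d-odd
  1≤b : 1 ≤ c + d + c
  1≤b = ≤-trans 1≤d (≤-trans (m≤n+m d c) (m≤m+n (c + d) c))

record FibState (P Q : ℕ → Set) (R : ℕ → ℕ → Set) (j : ℕ) : Set where
  constructor fibState
  field
    parity₀ : P (F j)
    parity₁ : Q (F (suc j))
    sign    : R (F (suc j)) (F (suc (suc j)))

next : ∀ {P Q S : ℕ → Set} {R R′ : ℕ → ℕ → Set} {j} →
       FibState P Q R j → (∀ {m n} → Q n → P m → S (n + m)) → (∀ m n → R m n → R′ n (n + m)) →
       FibState Q S R′ (suc j)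
next (fibState p q r) parity sign = fibState q (parity q p) (sign _ _ r)

-- Parities have period 3 along the sequence and the Cassini sign has period 2.
F-state₀ : ∀ q → FibState Even Odd  Cassini⁺ (q * 6)
F-state₁ : ∀ q → FibState Odd  Odd  Cassini⁻ (1 + q * 6)
F-state₂ : ∀ q → FibState Odd  Even Cassini⁺ (2 + q * 6)
F-state₃ : ∀ q → FibState Even Odd  Cassini⁻ (3 + q * 6)
F-state₄ : ∀ q → FibState Odd  Odd  Cassini⁺ (4 + q * 6)
F-state₅ : ∀ q → FibState Odd  Even Cassini⁻ (5 + q * 6)
F-state₀ zero    = fibState (divides 0 refl) (0 , refl) refl
F-state₀ (suc q) = next (F-state₅ q) even+odd cassini⁻-next
F-state₁ q       = next (F-state₀ q) odd+even cassini⁺-next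
F-state₂ q       = next (F-state₁ q) odd+odd  cassini⁻-next
F-state₃ q       = next (F-state₂ q) even+odd cassini⁺-next
F-state₄ q       = next (F-state₃ q) odd+even cassini⁻-next
F-state₅ q       = next (F-state₄ q) odd+odd  cassini⁺-next

FibPart : (ℕ → ℕ → ℕ → Set) → ℕ → Set
FibPart P n = P (F n ^ 2) (F (suc n) ^ 2) (F (n ∸ 1) ^ 2)

F-pos : ∀ n → 1 ≤ F (suc n)
F-pos zero    = s≤s z≤n
F-pos (suc n) = ≤-trans (F-pos n) (m≤m+n (F (suc n)) (F n))

F-part-i : ∀ {P R j} → (∀ {m n} → R m n → Cassini m n) → FibState P Odd R j →
           FibPart Part-i (suc (suc j))
F-part-i {j = j} cassini (fibState _ c-odd sign) = pair-part-i {d = F j} c-odd (cassini sign)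

F-part-ii : ∀ {j} → FibState Odd Even Cassini⁻ j → FibPart Part-ii (suc (suc j))
F-part-ii {j} (fibState d-odd c-even sign) = pair-part-ii c-even d-odd (F-pos j) sign

F-part-iii : ∀ {j} → FibState Odd Even Cassini⁺ j → FibPart Part-iii (suc (suc j))
F-part-iii (fibState d-odd c-even sign) = pair-part-iii c-even d-odd sign

part-i : ∀ n → 2 ≤ n → (n % 6 ≡ 0 ⊎ n % 6 ≡ 2 ⊎ n % 6 ≡ 3 ⊎ n % 6 ≡ 5) → FibPart Part-i n
part-i n 2≤n r = subst (FibPart Part-i) (sym n≡) (at (n % 6) (n / 6) r (subst (2 ≤_) n≡ 2≤n))
  where
  n≡ = m≡m%n+[m/n]*n n 6
  at : ∀ r q → (r ≡ 0 ⊎ r ≡ 2 ⊎ r ≡ 3 ⊎ r ≡ 5) → 2 ≤ r + q * 6 → FibPart Part-i (r + q * 6)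
  at .0 zero    (inj₁ refl)                ()
  at .0 (suc q) (inj₁ refl)                _ = F-part-i inj₁ (F-state₄ q)
  at .2 q       (inj₂ (inj₁ refl))         _ = F-part-i inj₁ (F-state₀ q)
  at .3 q       (inj₂ (inj₂ (inj₁ refl)))  _ = F-part-i inj₂ (F-state₁ q)
  at .5 q       (inj₂ (inj₂ (inj₂ refl)))  _ = F-part-i inj₂ (F-state₃ q)

part-ii : ∀ n → 2 ≤ n → n % 6 ≡ 1 → FibPart Part-ii n
part-ii n 2≤n r = subst (FibPart Part-ii) (sym n≡) (at (n % 6) (n / 6) r (subst (2 ≤_) n≡ 2≤n))
  where
  n≡ = m≡m%n+[m/n]*n n 6
  at : ∀ r q → r ≡ 1 → 2 ≤ r + q * 6 → FibPart Part-ii (r + q * 6)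
  at .1 zero    refl (s≤s ())
  at .1 (suc q) refl _ = F-part-ii (F-state₅ q)

part-iii : ∀ n → 2 ≤ n → n % 6 ≡ 4 → FibPart Part-iii n
part-iii n _ r = subst (FibPart Part-iii) (sym (m≡m%n+[m/n]*n n 6)) (at (n % 6) (n / 6) r)
  where
  at : ∀ r q → r ≡ 4 → FibPart Part-iii (r + q * 6)
  at .4 q refl = F-part-iii (F-state₂ q)

corollary1p4 :
    (∀ n → 2 ≤ n → (n % 6 ≡ 0 ⊎ n % 6 ≡ 2 ⊎ n % 6 ≡ 3 ⊎ n % 6 ≡ 5) →
      (2 ∣ F (n ∸ 1) ^ 2 + 1) × (2 ∣ F (n ∸ 1) ^ 2 ∸ 1) ×
      UniqueSol (EqA n) (F n ^ 2 ∸ (F (n ∸ 1) ^ 2 + 1) / 2) ((F (n ∸ 1) ^ 2 ∸ 1) / 2))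
    × (∀ n → 2 ≤ n → n % 6 ≡ 1 →
      (2 ∣ F n ^ 2 ∸ 3) × (2 ∣ F n ^ 2 ∸ F (n ∸ 1) ^ 2 ∸ 1) ×
      UniqueSol (EqB n) ((F n ^ 2 ∸ 3) / 2) ((F n ^ 2 ∸ F (n ∸ 1) ^ 2 ∸ 1) / 2))
    × (∀ n → 2 ≤ n → n % 6 ≡ 4 →
      (2 ∣ F n ^ 2 + 1) × (2 ∣ F n ^ 2 ∸ F (n ∸ 1) ^ 2 ∸ 1) ×
      UniqueSol (EqB n) ((F n ^ 2 + 1) / 2) ((F n ^ 2 ∸ F (n ∸ 1) ^ 2 ∸ 1) / 2))
corollary1p4 = part-i , part-ii , part-iii
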